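{- Let $S$ and $T$ be non-empty bitstrings of equal length. Then there exists $k\ge0$ such that the strings obtained from $S$ and from $T$ by applying the Wythoff Update $k$ times each differ by defects.
   Context: The Wythoff Update of a non-empty bitstring $S$: if the first character is $0$, change it to $1$ and append $0$ at the right end; if the first character is $1$, remove it and append $01$ at the right end. Two bitstrings are balanced if they have the same length and the same number of ones. Characters are indexed from $1$, $S[i]$ denoting the $i$-th character. For balanced $S,T$ of length $L$, a defect is an index $1\le i\le L-1$ such that the length-$(i-1)$ prefixes of $S$ and $T$ are balanced, $S[i]\neq T[i]$, $S[i]\neq S[i+1]$, and $S[i+1]\neq T[i+1]$. $S$ and $T$ differ by defects if they are balanced and for every index $1\le i\le L$ with $S[i]\neq T[i]$ there is a defect at index $i-1$ or at index $i$. -}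

module Defs where

open import Data.Bool using (Bool; true; false)
open import Data.List using (List; []; _∷_; _++_; length; take; filter)
open import Data.Nat using (ℕ; zero; suc; pred; _≤_; _<_)
open import Data.Product using (_×_; Σ)
open import Data.Sum using (_⊎_)
open import Data.Maybe using (Maybe; just; nothing)
open import Relation.Binary.PropositionalEquality using (_≡_; _≢_)
open import Data.Empty using (⊥)

-- Bitstrings: false = 0, true = 1.
Bitstring : Set
Bitstring = List Bool

-- Wythoff Update (only meaningful on non-empty strings; identity on []).
wythoff : Bitstring → Bitstring
wythoff []           = []
wythoff (false ∷ s)  = true ∷ (s ++ false ∷ [])
wythoff (true  ∷ s)  = s ++ false ∷ true ∷ []

iter : ℕ → (Bitstring → Bitstring) → Bitstring → Bitstring
iter zero    f s = s
iter (suc k) f s = f (iter k f s)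

ones : Bitstring → ℕ
ones []           = 0
ones (true  ∷ s)  = suc (ones s)
ones (false ∷ s)  = ones s

Balanced : Bitstring → Bitstring → Set
Balanced s t = (length s ≡ length t) × (ones s ≡ ones t)

-- 1-indexed character access: at s i = just (S[i]) for 1 ≤ i ≤ length s
at : Bitstring → ℕ → Maybe Bool
at []      _             = nothing
at (b ∷ s) zero          = nothing
at (b ∷ s) (suc zero)    = just b
at (b ∷ s) (suc (suc i)) = at s (suc i)

-- defect at index i (for balanced S, T of length L): 1 ≤ i ≤ L - 1,
-- prefixes of length i-1 balanced, S[i] ≠ T[i], S[i] ≠ S[i+1], S[i+1] ≠ T[i+1].
Defect : Bitstring → Bitstring → ℕ → Set
Defect s t zero    = ⊥
Defect s t (suc j) =
  (suc (suc j) ≤ length s) ×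
  Balanced (take j s) (take j t) ×
  (at s (suc j) ≢ at t (suc j)) ×
  (at s (suc j) ≢ at s (suc (suc j))) ×
  (at s (suc (suc j)) ≢ at t (suc (suc j)))

DifferByDefects : Bitstring → Bitstring → Set
DifferByDefects s t =
  Balanced s t ×
  (∀ i → 1 ≤ i → i ≤ length s → at s i ≢ at t i →
     Defect s t (pred i) ⊎ Defect s t i)

-- Consuming a string q with the Wythoff update takes cost q = |q| + #zeros(q) steps and appends σ q, where σ
-- replaces 0 by 001 and 1 by 01. After cost a steps, a has become σ a with cost a zeros, while b, still short of
-- its own cost b steps, has between cost a and cost b - 1 zeros; so the gap between the zero counts shrinks until
-- the strings are balanced. From then on both strings pass through their σ-images at the same times. Since the
-- j-th 1 of σ a sits at position 3 j - prefixOnes a j, σ turns a lead of prefix one-counts of at most 2 r into one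
-- of at most r, and a lead of at most 1 into prefix counts that never differ at two consecutive positions. Such
-- isolated differences are exactly defects.
module Submission where

open import Defs
open import Data.Bool using (Bool; true; false)
open import Data.List using (List; []; _∷_; _++_; [_]; _∷ʳ_; length; take; initLast; _∷ʳ′_)
open import Data.List.Properties using (length-++; ++-assoc; ++-identityʳ; length-take; take-all)
open import Data.Maybe using (Maybe; just)
open import Data.Maybe.Properties using (just-injective)
open import Data.Nat using (ℕ; zero; suc; pred; _+_; _*_; _∸_; _≤_; _<_; _≰_; z≤n; s≤s; z<s; _≟_; _≤?_; _⊓_; >-nonZero)
open import Data.Nat.Induction using (<-rec)
open import Data.Nat.Properties
open import Data.Nat.Tactic.RingSolver using (solve-∀)
open import Data.Product using (Σ; _×_; _,_; proj₁; proj₂; ∃-syntax)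
open import Data.Sum using (_⊎_; inj₁; inj₂)
open import Function using (_∘_)
open import Relation.Binary using (tri<; tri≈; tri>)
open import Relation.Binary.PropositionalEquality hiding ([_])
open import Relation.Nullary using (yes; no; contradiction)

zeros : Bitstring → ℕ
zeros []          = 0
zeros (false ∷ s) = suc (zeros s)
zeros (true  ∷ s) = zeros s

zeros+ones≡length : ∀ s → zeros s + ones s ≡ length s
zeros+ones≡length []          = refl
zeros+ones≡length (false ∷ s) = cong suc (zeros+ones≡length s)
zeros+ones≡length (true  ∷ s) = trans (+-suc (zeros s) (ones s)) (cong suc (zeros+ones≡length s))

zeros-++ : ∀ a b → zeros (a ++ b) ≡ zeros a + zeros b
zeros-++ []          b = refl
zeros-++ (false ∷ a) b = cong suc (zeros-++ a b)
zeros-++ (true  ∷ a) b = zeros-++ a b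

zeros+ones-≡ : ∀ a b → length a ≡ length b → zeros a + ones a ≡ zeros b + ones b
zeros+ones-≡ a b el = trans (zeros+ones≡length a) (trans el (sym (zeros+ones≡length b)))

Balanced-sym : ∀ a b → Balanced a b → Balanced b a
Balanced-sym _ _ (el , eo) = sym el , sym eo

Balanced⇒zeros≡ : ∀ a b → Balanced a b → zeros a ≡ zeros b
Balanced⇒zeros≡ a b (el , eo) =
  +-cancelʳ-≡ (ones a) (zeros a) (zeros b) (trans (zeros+ones-≡ a b el) (cong (zeros b +_) (sym eo)))

zeros≡⇒Balanced : ∀ a b → length a ≡ length b → zeros a ≡ zeros b → Balanced a b
zeros≡⇒Balanced a b el ez =
  el , +-cancelˡ-≡ (zeros a) (ones a) (ones b) (trans (zeros+ones-≡ a b el) (cong (_+ ones b) (sym ez)))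

iter-+ : ∀ m n (f : Bitstring → Bitstring) s → iter (m + n) f s ≡ iter m f (iter n f s)
iter-+ zero    n f s = refl
iter-+ (suc m) n f s = cong f (iter-+ m n f s)

iter-suc : ∀ n (f : Bitstring → Bitstring) s → iter (suc n) f s ≡ iter n f (f s)
iter-suc n f s = trans (cong (λ k → iter k f s) (+-comm 1 n)) (iter-+ n 1 f s)

Eventually : (Bitstring → Bitstring → Set) → Bitstring → Bitstring → Set
Eventually R a b = ∃[ k ] R (iter k wythoff a) (iter k wythoff b)

Eventually-iter : ∀ {R} k a b → Eventually R (iter k wythoff a) (iter k wythoff b) → Eventually R a b
Eventually-iter {R} k a b (m , r) =
  m + k , subst₂ R (sym (iter-+ m k wythoff a)) (sym (iter-+ m k wythoff b)) r

length-wythoff : ∀ a b → length a ≡ length b → length (wythoff a) ≡ length (wythoff b)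
length-wythoff []      []      _  = refl
length-wythoff (x ∷ a) (y ∷ b) el = trans (grow x a) (trans (cong suc el) (sym (grow y b)))
  where
  grow : ∀ x s → length (wythoff (x ∷ s)) ≡ suc (suc (length s))
  grow false s = cong suc (trans (length-++ s) (+-comm (length s) 1))
  grow true  s = trans (length-++ s) (+-comm (length s) 2)

length-iter : ∀ k {a b} → length a ≡ length b → length (iter k wythoff a) ≡ length (iter k wythoff b)
length-iter zero            el = el
length-iter (suc k) {a} {b} el = length-wythoff (iter k wythoff a) (iter k wythoff b) (length-iter k el)

σ : Bitstring → Bitstring
σ []          = []
σ (false ∷ s) = false ∷ false ∷ true ∷ σ s
σ (true  ∷ s) = false ∷ true ∷ σ s

cost : Bitstring → ℕ
cost s = length s + zeros s

-- A leading 1 is consumed in one update, appending 01; a leading 0 takes two, appending 001.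
iter-cost-++ : ∀ q r → iter (cost q) wythoff (q ++ r) ≡ r ++ σ q
iter-cost-++ [] r = sym (++-identityʳ r)
iter-cost-++ (true ∷ q) r = begin
  iter (suc (cost q)) wythoff (true ∷ q ++ r)            ≡⟨ iter-suc (cost q) wythoff _ ⟩
  iter (cost q) wythoff ((q ++ r) ++ false ∷ true ∷ [])  ≡⟨ cong (iter (cost q) wythoff) (++-assoc q r _) ⟩
  iter (cost q) wythoff (q ++ r ++ false ∷ true ∷ [])    ≡⟨ iter-cost-++ q _ ⟩
  (r ++ false ∷ true ∷ []) ++ σ q                        ≡⟨ ++-assoc r _ (σ q) ⟩
  r ++ σ (true ∷ q)                                      ∎
  where open ≡-Reasoning
iter-cost-++ (false ∷ q) r = begin
  iter (cost (false ∷ q)) wythoff (false ∷ q ++ r)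
    ≡⟨ cong (λ k → iter (suc k) wythoff (false ∷ q ++ r)) (+-suc (length q) (zeros q)) ⟩
  iter (suc (suc (cost q))) wythoff (false ∷ q ++ r)
    ≡⟨ iter-suc (suc (cost q)) wythoff _ ⟩
  iter (suc (cost q)) wythoff (true ∷ (q ++ r) ++ [ false ])
    ≡⟨ iter-suc (cost q) wythoff _ ⟩
  iter (cost q) wythoff (((q ++ r) ++ [ false ]) ++ false ∷ true ∷ [])
    ≡⟨ cong (iter (cost q) wythoff) (trans (++-assoc (q ++ r) _ _) (++-assoc q r _)) ⟩
  iter (cost q) wythoff (q ++ r ++ false ∷ false ∷ true ∷ [])
    ≡⟨ iter-cost-++ q _ ⟩
  (r ++ false ∷ false ∷ true ∷ []) ++ σ q
    ≡⟨ ++-assoc r _ (σ q) ⟩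
  r ++ σ (false ∷ q)
    ∎
  where open ≡-Reasoning

iter-cost : ∀ q → iter (cost q) wythoff q ≡ σ q
iter-cost q = trans (cong (iter (cost q) wythoff) (sym (++-identityʳ q))) (iter-cost-++ q [])

zeros-σ : ∀ q → zeros (σ q) ≡ cost q
zeros-σ []          = refl
zeros-σ (false ∷ q) = cong suc (trans (cong suc (zeros-σ q)) (sym (+-suc (length q) (zeros q))))
zeros-σ (true  ∷ q) = cong suc (zeros-σ q)

ones-σ : ∀ q → ones (σ q) ≡ length q
ones-σ []          = refl
ones-σ (false ∷ q) = cong suc (ones-σ q)
ones-σ (true  ∷ q) = cong suc (ones-σ q)

cost-Balanced : ∀ a b → Balanced a b → cost a ≡ cost b
cost-Balanced a b bal = cong₂ _+_ (proj₁ bal) (Balanced⇒zeros≡ a b bal)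

σ-Balanced : ∀ a b → Balanced a b → Balanced (σ a) (σ b)
σ-Balanced a b bal = zeros≡⇒Balanced (σ a) (σ b) length-σ≡ zeros-σ≡
  where
  length-σ : ∀ q → length (σ q) ≡ cost q + length q
  length-σ q = trans (sym (zeros+ones≡length (σ q))) (cong₂ _+_ (zeros-σ q) (ones-σ q))
  length-σ≡ : length (σ a) ≡ length (σ b)
  length-σ≡ = trans (length-σ a) (trans (cong₂ _+_ (cost-Balanced a b bal) (proj₁ bal)) (sym (length-σ b)))
  zeros-σ≡ : zeros (σ a) ≡ zeros (σ b)
  zeros-σ≡ = trans (zeros-σ a) (trans (cost-Balanced a b bal) (sym (zeros-σ b)))

σⁿ-Balanced : ∀ {a b} → Balanced a b → ∀ n → Balanced (iter n σ a) (iter n σ b)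
σⁿ-Balanced bal zero            = bal
σⁿ-Balanced {a} {b} bal (suc n) = σ-Balanced (iter n σ a) (iter n σ b) (σⁿ-Balanced bal n)

iter-σⁿ : ∀ {a b} → Balanced a b → ∀ n → ∃[ k ] iter k wythoff a ≡ iter n σ a × iter k wythoff b ≡ iter n σ b
iter-σⁿ bal zero = 0 , refl , refl
iter-σⁿ {a} {b} bal (suc n) with iter-σⁿ bal n
... | k , a≡ , b≡ = c + k , step a a≡ , trans (cong (λ c′ → iter (c′ + k) wythoff b) c≡) (step b b≡)
  where
  c = cost (iter n σ a)
  c≡ : c ≡ cost (iter n σ b)
  c≡ = cost-Balanced (iter n σ a) (iter n σ b) (σⁿ-Balanced bal n)
  step : ∀ s → iter k wythoff s ≡ iter n σ s → iter (cost (iter n σ s) + k) wythoff s ≡ iter (suc n) σ s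
  step s e = begin
    iter (cost (iter n σ s) + k) wythoff s               ≡⟨ iter-+ (cost (iter n σ s)) k wythoff s ⟩
    iter (cost (iter n σ s)) wythoff (iter k wythoff s)  ≡⟨ cong (iter (cost (iter n σ s)) wythoff) e ⟩
    iter (cost (iter n σ s)) wythoff (iter n σ s)        ≡⟨ iter-cost (iter n σ s) ⟩
    iter (suc n) σ s                                     ∎
    where open ≡-Reasoning

-- Reaching balance

zeros-wythoff : ∀ s → zeros (wythoff s) ≡ zeros s ⊎ zeros (wythoff s) ≡ suc (zeros s)
zeros-wythoff []          = inj₁ refl
zeros-wythoff (false ∷ s) = inj₁ (trans (zeros-++ s [ false ]) (+-comm (zeros s) 1))
zeros-wythoff (true  ∷ s) = inj₂ (trans (zeros-++ s (false ∷ true ∷ [])) (+-comm (zeros s) 1))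

zeros-iter-≥ : ∀ k s → zeros s ≤ zeros (iter k wythoff s)
zeros-iter-≥ zero    s = ≤-refl
zeros-iter-≥ (suc k) s with zeros-wythoff (iter k wythoff s)
... | inj₁ e = ≤-trans (zeros-iter-≥ k s) (≤-reflexive (sym e))
... | inj₂ e = ≤-trans (zeros-iter-≥ k s) (≤-trans (n≤1+n _) (≤-reflexive (sym e)))

zeros-iter-≤ : ∀ k s → zeros (iter k wythoff s) ≤ k + zeros s
zeros-iter-≤ zero    s = ≤-refl
zeros-iter-≤ (suc k) s with zeros-wythoff (iter k wythoff s)
... | inj₁ e = ≤-trans (≤-reflexive e) (m≤n⇒m≤1+n (zeros-iter-≤ k s))
... | inj₂ e = ≤-trans (≤-reflexive e) (s≤s (zeros-iter-≤ k s))

cost-∷ʳ : ∀ c x → cost (c ∷ʳ x) ≡ cost [ x ] + cost c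
cost-∷ʳ c x = begin
  length (c ∷ʳ x) + zeros (c ∷ʳ x)          ≡⟨ cong₂ _+_ (length-++ c) (zeros-++ c [ x ]) ⟩
  (length c + 1) + (zeros c + zeros [ x ])  ≡⟨ rearrange (length c) (zeros c) (zeros [ x ]) ⟩
  (1 + zeros [ x ]) + cost c                ∎
  where
  open ≡-Reasoning
  rearrange : ∀ l z w → (l + 1) + (z + w) ≡ (1 + w) + (l + z)
  rearrange = solve-∀

zeros-before-last-step : ∀ s → 0 < cost s → zeros (iter (pred (cost s)) wythoff s) ≡ pred (cost s)
zeros-before-last-step s 0<cost with initLast s
... | []      = contradiction 0<cost λ ()
... | c ∷ʳ′ x = subst (λ n → zeros (iter (pred n) wythoff (c ∷ʳ x)) ≡ pred n) (sym (cost-∷ʳ c x)) (last x)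
  where
  last : ∀ x → zeros (iter (pred (cost [ x ] + cost c)) wythoff (c ∷ʳ x)) ≡ pred (cost [ x ] + cost c)
  last true  = trans (cong zeros (iter-cost-++ c [ true ])) (zeros-σ c)
  last false = begin
    zeros (wythoff (iter (cost c) wythoff (c ∷ʳ false)))  ≡⟨ cong (zeros ∘ wythoff) (iter-cost-++ c [ false ]) ⟩
    zeros (σ c ++ [ false ])                              ≡⟨ zeros-++ (σ c) [ false ] ⟩
    zeros (σ c) + 1                                       ≡⟨ cong (_+ 1) (zeros-σ c) ⟩
    cost c + 1                                            ≡⟨ +-comm (cost c) 1 ⟩
    suc (cost c)                                          ∎
    where open ≡-Reasoning

zeros-iter-bounds : ∀ {k} s → k < cost s → k ≤ zeros (iter k wythoff s) × zeros (iter k wythoff s) < cost s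
zeros-iter-bounds {k} s k<cost = lower , upper
  where
  0<cost : 0 < cost s
  0<cost = ≤-<-trans z≤n k<cost
  N = pred (cost s)
  d = N ∸ k
  zeros-N : zeros (iter d wythoff (iter k wythoff s)) ≡ N
  zeros-N = begin
    zeros (iter d wythoff (iter k wythoff s))  ≡⟨ cong zeros (iter-+ d k wythoff s) ⟨
    zeros (iter (d + k) wythoff s)             ≡⟨ cong (λ n → zeros (iter n wythoff s)) (m∸n+n≡m (<⇒≤pred k<cost)) ⟩
    zeros (iter N wythoff s)                   ≡⟨ zeros-before-last-step s 0<cost ⟩
    N                                          ∎
    where open ≡-Reasoning
  lower : k ≤ zeros (iter k wythoff s)
  lower = +-cancelˡ-≤ d k _ (begin
    d + k                                      ≡⟨ +-comm d k ⟩
    k + d                                      ≡⟨ m+[n∸m]≡n (<⇒≤pred k<cost) ⟩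
    N                                          ≡⟨ zeros-N ⟨
    zeros (iter d wythoff (iter k wythoff s))  ≤⟨ zeros-iter-≤ d (iter k wythoff s) ⟩
    d + zeros (iter k wythoff s)               ∎)
    where open ≤-Reasoning
  upper : zeros (iter k wythoff s) < cost s
  upper = m≤pred[n]⇒suc[m]≤n {{>-nonZero 0<cost}}
    (≤-trans (zeros-iter-≥ d (iter k wythoff s)) (≤-reflexive zeros-N))

zeros-gap-shrinks : ∀ {δ} a b → length a ≡ length b → zeros a + suc δ ≡ zeros b →
  ∃[ δ′ ] δ′ < suc δ × zeros (iter (cost a) wythoff a) + δ′ ≡ zeros (iter (cost a) wythoff b)
zeros-gap-shrinks {δ} a b el ez = zb ∸ cost a , gap< , gap≡
  where
  zb = zeros (iter (cost a) wythoff b)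
  cost-b : cost a + suc δ ≡ cost b
  cost-b = trans (+-assoc (length a) (zeros a) (suc δ)) (cong₂ _+_ el ez)
  bounds : cost a ≤ zb × zb < cost a + suc δ
  bounds = subst (λ n → cost a ≤ zb × zb < n) (sym cost-b)
    (zeros-iter-bounds b (subst (cost a <_) cost-b (m<m+n (cost a) z<s)))
  gap< : zb ∸ cost a < suc δ
  gap< = subst (zb ∸ cost a <_) (m+n∸m≡n (cost a) (suc δ)) (∸-monoˡ-< (proj₂ bounds) (proj₁ bounds))
  gap≡ : zeros (iter (cost a) wythoff a) + (zb ∸ cost a) ≡ zb
  gap≡ = begin
    zeros (iter (cost a) wythoff a) + (zb ∸ cost a)  ≡⟨ cong (λ s → zeros s + (zb ∸ cost a)) (iter-cost a) ⟩
    zeros (σ a) + (zb ∸ cost a)                      ≡⟨ cong (_+ (zb ∸ cost a)) (zeros-σ a) ⟩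
    cost a + (zb ∸ cost a)                           ≡⟨ m+[n∸m]≡n (proj₁ bounds) ⟩
    zb                                               ∎
    where open ≡-Reasoning

Eventually-Balanced-gap : ∀ δ a b → length a ≡ length b → zeros a + δ ≡ zeros b → Eventually Balanced a b
Eventually-Balanced-gap = <-rec _ go
  where
  go : ∀ δ → (∀ {δ′} → δ′ < δ → ∀ a b → length a ≡ length b → zeros a + δ′ ≡ zeros b → Eventually Balanced a b) →
       ∀ a b → length a ≡ length b → zeros a + δ ≡ zeros b → Eventually Balanced a b
  go zero    _   a b el ez = 0 , zeros≡⇒Balanced a b el (trans (sym (+-identityʳ (zeros a))) ez)
  go (suc δ) rec a b el ez with zeros-gap-shrinks a b el ez
  ... | δ′ , δ′<δ , ez′ = Eventually-iter {Balanced} (cost a) a b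
    (rec δ′<δ (iter (cost a) wythoff a) (iter (cost a) wythoff b) (length-iter (cost a) el) ez′)

Eventually-Balanced : ∀ a b → length a ≡ length b → Eventually Balanced a b
Eventually-Balanced a b el with ≤-total (zeros a) (zeros b)
... | inj₁ za≤zb = Eventually-Balanced-gap _ a b el (m+[n∸m]≡n za≤zb)
... | inj₂ zb≤za with Eventually-Balanced-gap _ b a (sym el) (m+[n∸m]≡n zb≤za)
...   | k , bal = k , Balanced-sym (iter k wythoff b) (iter k wythoff a) bal

-- Prefix counts of ones under σ

toℕ : Bool → ℕ
toℕ false = 0
toℕ true  = 1

toℕ-injective : ∀ {x y} → toℕ x ≡ toℕ y → x ≡ y
toℕ-injective {false} {false} _ = refl
toℕ-injective {true}  {true}  _ = refl

prefixOnes : Bitstring → ℕ → ℕ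
prefixOnes s j = ones (take j s)

prefixOnes≤ : ∀ s j → prefixOnes s j ≤ j
prefixOnes≤ s           zero    = z≤n
prefixOnes≤ []          (suc j) = z≤n
prefixOnes≤ (false ∷ s) (suc j) = m≤n⇒m≤1+n (prefixOnes≤ s j)
prefixOnes≤ (true  ∷ s) (suc j) = s≤s (prefixOnes≤ s j)

prefixOnes≤ones : ∀ s j → prefixOnes s j ≤ ones s
prefixOnes≤ones s           zero    = z≤n
prefixOnes≤ones []          (suc j) = z≤n
prefixOnes≤ones (false ∷ s) (suc j) = prefixOnes≤ones s j
prefixOnes≤ones (true  ∷ s) (suc j) = s≤s (prefixOnes≤ones s j)

prefixOnes-+ : ∀ s j r → prefixOnes s (j + r) ≤ prefixOnes s j + r
prefixOnes-+ s           zero    r = prefixOnes≤ s r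
prefixOnes-+ []          (suc j) r = z≤n
prefixOnes-+ (false ∷ s) (suc j) r = prefixOnes-+ s j r
prefixOnes-+ (true  ∷ s) (suc j) r = s≤s (prefixOnes-+ s j r)

prefixOnes-suc : ∀ s j → prefixOnes s (suc j) ≤ suc (prefixOnes s j)
prefixOnes-suc s j =
  subst₂ _≤_ (cong (prefixOnes s) (+-comm j 1)) (+-comm (prefixOnes s j) 1) (prefixOnes-+ s j 1)

prefixOnes-length : ∀ s → prefixOnes s (length s) ≡ ones s
prefixOnes-length s = cong ones (take-all (length s) s ≤-refl)

prefixOnes-σ≤length : ∀ a m → prefixOnes (σ a) m ≤ length a
prefixOnes-σ≤length a m = ≤-trans (prefixOnes≤ones (σ a) m) (≤-reflexive (ones-σ a))

-- The j-th 1 of σ a closes the block of the j-th letter of a, at position 3 j - prefixOnes a j.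
j≤prefixOnes-σ⇒ : ∀ a j m → j ≤ prefixOnes (σ a) m → 3 * j ≤ m + prefixOnes a j
j≤prefixOnes-σ⇒ a zero m _ = z≤n
j≤prefixOnes-σ⇒ [] (suc j) zero ()
j≤prefixOnes-σ⇒ [] (suc j) (suc m) ()
j≤prefixOnes-σ⇒ (false ∷ a) (suc j) zero ()
j≤prefixOnes-σ⇒ (false ∷ a) (suc j) (suc zero) ()
j≤prefixOnes-σ⇒ (false ∷ a) (suc j) (suc (suc zero)) ()
j≤prefixOnes-σ⇒ (false ∷ a) (suc j) (suc (suc (suc m))) (s≤s j≤) =
  subst (_≤ 3 + (m + prefixOnes a j)) (sym (*-suc 3 j)) (+-monoʳ-≤ 3 (j≤prefixOnes-σ⇒ a j m j≤))
j≤prefixOnes-σ⇒ (true ∷ a) (suc j) zero ()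
j≤prefixOnes-σ⇒ (true ∷ a) (suc j) (suc zero) ()
j≤prefixOnes-σ⇒ (true ∷ a) (suc j) (suc (suc m)) (s≤s j≤) =
  subst₂ _≤_ (sym (*-suc 3 j)) (cong (2 +_) (sym (+-suc m (prefixOnes a j))))
    (+-monoʳ-≤ 3 (j≤prefixOnes-σ⇒ a j m j≤))

3*suc≰ : ∀ {n j} → n ≤ 2 + j → 3 * suc j ≰ n
3*suc≰ {n} {j} n≤ h = <⇒≱ 2+j<3*suc-j (≤-trans h n≤)
  where
  2+j<3*suc-j : 2 + j < 3 * suc j
  2+j<3*suc-j = subst (2 + j <_) (sym (*-suc 3 j)) (+-monoʳ-≤ 3 (m≤n*m j 3))

⇒j≤prefixOnes-σ : ∀ a j m → j ≤ length a → 3 * j ≤ m + prefixOnes a j → j ≤ prefixOnes (σ a) m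
⇒j≤prefixOnes-σ a zero m _ _ = z≤n
⇒j≤prefixOnes-σ (false ∷ a) (suc j) zero _ h =
  contradiction h (3*suc≰ (m≤n⇒m≤o+n 2 (prefixOnes≤ a j)))
⇒j≤prefixOnes-σ (false ∷ a) (suc j) (suc zero) _ h =
  contradiction h (3*suc≰ (s≤s (m≤n⇒m≤1+n (prefixOnes≤ a j))))
⇒j≤prefixOnes-σ (false ∷ a) (suc j) (suc (suc zero)) _ h =
  contradiction h (3*suc≰ (s≤s (s≤s (prefixOnes≤ a j))))
⇒j≤prefixOnes-σ (false ∷ a) (suc j) (suc (suc (suc m))) (s≤s j≤) h =
  s≤s (⇒j≤prefixOnes-σ a j m j≤ (+-cancelˡ-≤ 3 _ _ (subst (_≤ 3 + (m + prefixOnes a j)) (*-suc 3 j) h)))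
⇒j≤prefixOnes-σ (true ∷ a) (suc j) zero _ h =
  contradiction h (3*suc≰ (m≤n⇒m≤1+n (s≤s (prefixOnes≤ a j))))
⇒j≤prefixOnes-σ (true ∷ a) (suc j) (suc zero) _ h =
  contradiction h (3*suc≰ (s≤s (s≤s (prefixOnes≤ a j))))
⇒j≤prefixOnes-σ (true ∷ a) (suc j) (suc (suc m)) (s≤s j≤) h =
  s≤s (⇒j≤prefixOnes-σ a j m j≤ (≤-pred (subst (suc (3 * j) ≤_) (+-suc m (prefixOnes a j))
    (+-cancelˡ-≤ 2 _ _ (subst (_≤ 2 + (m + suc (prefixOnes a j))) (*-suc 3 j) h)))))

prefixOnes-σ<⇒ : ∀ a j m → j ≤ length a → prefixOnes (σ a) m < j → m + prefixOnes a j < 3 * j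
prefixOnes-σ<⇒ a j m j≤ P<j = ≰⇒> (λ 3j≤ → <⇒≱ P<j (⇒j≤prefixOnes-σ a j m j≤ 3j≤))

prefixOnes-σ≡ : ∀ a j m → j ≤ length a → 3 * j ≤ m + prefixOnes a j → m + prefixOnes a (suc j) < 3 * suc j →
  prefixOnes (σ a) m ≡ j
prefixOnes-σ≡ a j m j≤ lower upper =
  ≤-antisym (≮⇒≥ (λ j<P → <⇒≱ upper (j≤prefixOnes-σ⇒ a (suc j) m j<P))) (⇒j≤prefixOnes-σ a j m j≤ lower)

PrefixLead≤ : Bitstring → Bitstring → ℕ → Set
PrefixLead≤ a b M = ∀ p → prefixOnes a p ≤ prefixOnes b p + M

PrefixLead≤-length : ∀ a b → PrefixLead≤ a b (suc (length a))
PrefixLead≤-length a b p =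
  ≤-trans (prefixOnes≤ones a p) (≤-trans (ones≤length a) (≤-trans (n≤1+n _) (m≤n+m _ (prefixOnes b p))))
  where
  ones≤length : ∀ s → ones s ≤ length s
  ones≤length []          = z≤n
  ones≤length (false ∷ s) = m≤n⇒m≤1+n (ones≤length s)
  ones≤length (true  ∷ s) = s≤s (ones≤length s)

σ-lead-excess : ∀ {M} a b r m → length a ≡ length b → PrefixLead≤ a b M →
  prefixOnes (σ b) m + suc r ≤ prefixOnes (σ a) m → r + r < M
σ-lead-excess {M} a b r m el lead excess = +-cancelˡ-< (3 * i + r) (r + r) M (begin-strict
  (3 * i + r) + (r + r)          ≡⟨ expand i r ⟩
  3 * j                          ≤⟨ j≤prefixOnes-σ⇒ a j m j≤ ⟩
  m + prefixOnes a j             ≤⟨ +-monoʳ-≤ m (lead j) ⟩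
  m + (prefixOnes b j + M)       ≤⟨ +-monoʳ-≤ m (+-monoˡ-≤ M (prefixOnes-+ b i r)) ⟩
  m + ((prefixOnes b i + r) + M) ≡⟨ regroup m (prefixOnes b i) r M ⟩
  (m + prefixOnes b i) + (r + M) <⟨ +-monoˡ-< (r + M) (prefixOnes-σ<⇒ b i m i≤ (n<1+n _)) ⟩
  3 * i + (r + M)                ≡⟨ +-assoc (3 * i) r M ⟨
  (3 * i + r) + M                ∎)
  where
  open ≤-Reasoning
  i = suc (prefixOnes (σ b) m)
  j = i + r
  j≤ : j ≤ prefixOnes (σ a) m
  j≤ = subst (_≤ prefixOnes (σ a) m) (+-suc (prefixOnes (σ b) m) r) excess
  i≤ : i ≤ length b
  i≤ = ≤-trans (m≤m+n i r) (≤-trans (≤-trans j≤ (prefixOnes-σ≤length a m)) (≤-reflexive el))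
  expand : ∀ i r → (3 * i + r) + (r + r) ≡ 3 * (i + r)
  expand = solve-∀
  regroup : ∀ m p r M → m + ((p + r) + M) ≡ (m + p) + (r + M)
  regroup = solve-∀

σ-PrefixLead≤ : ∀ {M} a b r → length a ≡ length b → PrefixLead≤ a b M → M ≤ r + r →
  PrefixLead≤ (σ a) (σ b) r
σ-PrefixLead≤ a b r el lead M≤ m with prefixOnes (σ a) m ≤? prefixOnes (σ b) m + r
... | yes within = within
... | no  beyond = contradiction M≤
  (<⇒≱ (σ-lead-excess a b r m el lead (subst (_≤ prefixOnes (σ a) m) (sym (+-suc _ r)) (≰⇒> beyond))))

σⁿ-PrefixLead≤ : ∀ n {a b} → Balanced a b → PrefixLead≤ a b (suc n) →
  PrefixLead≤ (iter n σ a) (iter n σ b) 1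
σⁿ-PrefixLead≤ zero    bal lead = lead
σⁿ-PrefixLead≤ (suc n) {a} {b} bal lead =
  subst₂ (λ a′ b′ → PrefixLead≤ a′ b′ 1) (sym (iter-suc n σ a)) (sym (iter-suc n σ b))
    (σⁿ-PrefixLead≤ n (σ-Balanced a b bal)
      (σ-PrefixLead≤ a b (suc n) (proj₁ bal) lead (s≤s (m≤n+m (suc n) n))))

IsolatedImbalances : Bitstring → Bitstring → Set
IsolatedImbalances s t = ∀ m → prefixOnes s m ≢ prefixOnes t m → prefixOnes s (suc m) ≡ prefixOnes t (suc m)

prefixOnes-σ-suc≡ : ∀ a j m → j ≤ length a → 3 * j ≤ suc (m + prefixOnes a j) → m + prefixOnes a j ≤ 3 * j →
  prefixOnes (σ a) (suc m) ≡ j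
prefixOnes-σ-suc≡ a j m j≤ lower upper = prefixOnes-σ≡ a j (suc m) j≤ lower (begin-strict
  suc m + prefixOnes a (suc j)    ≤⟨ +-monoʳ-≤ (suc m) (prefixOnes-suc a j) ⟩
  suc m + suc (prefixOnes a j)    ≡⟨ cong suc (+-suc m (prefixOnes a j)) ⟩
  suc (suc (m + prefixOnes a j))  <⟨ s≤s (s≤s (s≤s upper)) ⟩
  3 + 3 * j                       ≡⟨ *-suc 3 j ⟨
  3 * suc j                       ∎)
  where open ≤-Reasoning

-- With j = prefixOnes (σ b) m + 1, the lead bound pins m + prefixOnes a j and m + prefixOnes b j + 1 to 3 j,
-- so that both σ a and σ b contain exactly j ones among their first m + 1 letters.
σ-imbalance-resolves : ∀ a b m → length a ≡ length b → PrefixLead≤ a b 1 →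
  prefixOnes (σ b) m < prefixOnes (σ a) m → prefixOnes (σ a) (suc m) ≡ prefixOnes (σ b) (suc m)
σ-imbalance-resolves a b m el lead B<A =
  trans (prefixOnes-σ-suc≡ a j m j≤a (m≤n⇒m≤1+n a-lower) a-upper)
        (sym (prefixOnes-σ-suc≡ b j m j≤b (≤-trans a-lower b-bound) (<⇒≤ b-upper)))
  where
  j = suc (prefixOnes (σ b) m)
  j≤a : j ≤ length a
  j≤a = ≤-trans B<A (prefixOnes-σ≤length a m)
  j≤b : j ≤ length b
  j≤b = ≤-trans j≤a (≤-reflexive el)
  a-lower : 3 * j ≤ m + prefixOnes a j
  a-lower = j≤prefixOnes-σ⇒ a j m B<A
  b-upper : m + prefixOnes b j < 3 * j
  b-upper = prefixOnes-σ<⇒ b j m j≤b (n<1+n _)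
  b-bound : m + prefixOnes a j ≤ suc (m + prefixOnes b j)
  b-bound = ≤-trans (+-monoʳ-≤ m (lead j))
    (≤-reflexive (trans (cong (m +_) (+-comm (prefixOnes b j) 1)) (+-suc m _)))
  a-upper : m + prefixOnes a j ≤ 3 * j
  a-upper = ≤-trans b-bound b-upper

σ-IsolatedImbalances : ∀ a b → length a ≡ length b → PrefixLead≤ a b 1 → PrefixLead≤ b a 1 →
  IsolatedImbalances (σ a) (σ b)
σ-IsolatedImbalances a b el lead-ab lead-ba m P≢ with <-cmp (prefixOnes (σ a) m) (prefixOnes (σ b) m)
... | tri< A<B _ _ = sym (σ-imbalance-resolves b a m (sym el) lead-ba A<B)
... | tri≈ _ A≡B _ = contradiction A≡B P≢
... | tri> _ _ B<A = σ-imbalance-resolves a b m el lead-ab B<A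

prefixOnes-at : ∀ s j → suc j ≤ length s →
  ∃[ x ] at s (suc j) ≡ just x × prefixOnes s (suc j) ≡ prefixOnes s j + toℕ x
prefixOnes-at (false ∷ s) zero    _       = false , refl , refl
prefixOnes-at (true  ∷ s) zero    _       = true , refl , refl
prefixOnes-at (y ∷ s)     (suc j) (s≤s ≤) with prefixOnes-at s j ≤
... | x , at≡ , P≡ = x , at≡ , step y
  where
  step : ∀ y → ones (y ∷ take (suc j) s) ≡ ones (y ∷ take j s) + toℕ x
  step false = P≡
  step true  = cong suc P≡

bits-defect : ∀ x₀ y₀ x y → x₀ ≢ y₀ → toℕ x₀ + toℕ x ≡ toℕ y₀ + toℕ y → x₀ ≢ x × x ≢ y
bits-defect false false _     _     x₀≢y₀ _  = contradiction refl x₀≢y₀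
bits-defect true  true  _     _     x₀≢y₀ _  = contradiction refl x₀≢y₀
bits-defect false true  true  false _     _  = (λ ()) , (λ ())
bits-defect true  false false true  _     _  = (λ ()) , (λ ())
bits-defect false true  false _     _     ()
bits-defect false true  true  true  _     ()
bits-defect true  false true  false _     ()
bits-defect true  false true  true  _     ()
bits-defect true  false false false _     ()

just-≢ : ∀ {u v : Maybe Bool} {x y} → u ≡ just x → v ≡ just y → x ≢ y → u ≢ v
just-≢ at-s at-t x≢y e = x≢y (just-injective (trans (sym at-s) (trans e at-t)))

defect-between-balances : ∀ s t j → suc (suc j) ≤ length s → length s ≡ length t →
  prefixOnes s j ≡ prefixOnes t j → prefixOnes s (suc j) ≢ prefixOnes t (suc j) →
  prefixOnes s (suc (suc j)) ≡ prefixOnes t (suc (suc j)) → Defect s t (suc j)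
defect-between-balances s t j ssj≤ el P₀≡ P₁≢ P₂≡
  with prefixOnes-at s j (≤-trans (n≤1+n _) ssj≤)
     | prefixOnes-at t j (≤-trans (n≤1+n _) (≤-trans ssj≤ (≤-reflexive el)))
     | prefixOnes-at s (suc j) ssj≤
     | prefixOnes-at t (suc j) (≤-trans ssj≤ (≤-reflexive el))
... | x₀ , at-x₀ , Ps₁ | y₀ , at-y₀ , Pt₁ | x , at-x , Ps₂ | y , at-y , Pt₂ =
  ssj≤ , (length-take-≡ , P₀≡) , just-≢ at-x₀ at-y₀ x₀≢y₀ , just-≢ at-x₀ at-x x₀≢x , just-≢ at-x at-y x≢y
  where
  length-take-≡ : length (take j s) ≡ length (take j t)
  length-take-≡ = trans (length-take j s) (trans (cong (j ⊓_) el) (sym (length-take j t)))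
  x₀≢y₀ : x₀ ≢ y₀
  x₀≢y₀ x₀≡y₀ = P₁≢ (trans Ps₁ (trans (cong₂ _+_ P₀≡ (cong toℕ x₀≡y₀)) (sym Pt₁)))
  sums≡ : toℕ x₀ + toℕ x ≡ toℕ y₀ + toℕ y
  sums≡ = +-cancelˡ-≡ (prefixOnes s j) _ _ (begin
    prefixOnes s j + (toℕ x₀ + toℕ x)  ≡⟨ +-assoc (prefixOnes s j) (toℕ x₀) (toℕ x) ⟨
    (prefixOnes s j + toℕ x₀) + toℕ x  ≡⟨ cong (_+ toℕ x) Ps₁ ⟨
    prefixOnes s (suc j) + toℕ x      ≡⟨ Ps₂ ⟨
    prefixOnes s (suc (suc j))        ≡⟨ P₂≡ ⟩
    prefixOnes t (suc (suc j))        ≡⟨ Pt₂ ⟩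
    prefixOnes t (suc j) + toℕ y      ≡⟨ cong (_+ toℕ y) Pt₁ ⟩
    (prefixOnes t j + toℕ y₀) + toℕ y  ≡⟨ +-assoc (prefixOnes t j) (toℕ y₀) (toℕ y) ⟩
    prefixOnes t j + (toℕ y₀ + toℕ y)  ≡⟨ cong (_+ (toℕ y₀ + toℕ y)) P₀≡ ⟨
    prefixOnes s j + (toℕ y₀ + toℕ y)  ∎)
    where open ≡-Reasoning
  x₀≢x : x₀ ≢ x
  x₀≢x = proj₁ (bits-defect x₀ y₀ x y x₀≢y₀ sums≡)
  x≢y : x ≢ y
  x≢y = proj₂ (bits-defect x₀ y₀ x y x₀≢y₀ sums≡)

prefixOnes-suc-≢ : ∀ s t j → suc j ≤ length s → length s ≡ length t → prefixOnes s j ≡ prefixOnes t j →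
  at s (suc j) ≢ at t (suc j) → prefixOnes s (suc j) ≢ prefixOnes t (suc j)
prefixOnes-suc-≢ s t j sj≤ el P₀≡ at≢ P₁≡
  with prefixOnes-at s j sj≤ | prefixOnes-at t j (≤-trans sj≤ (≤-reflexive el))
... | x , at-x , Ps | y , at-y , Pt = at≢ (trans at-x (trans (cong just x≡y) (sym at-y)))
  where
  x≡y : x ≡ y
  x≡y = toℕ-injective (+-cancelˡ-≡ (prefixOnes s j) _ _
    (trans (sym Ps) (trans P₁≡ (trans Pt (cong (_+ toℕ y) (sym P₀≡))))))

imbalance<length : ∀ s t j → Balanced s t → j ≤ length s → prefixOnes s j ≢ prefixOnes t j → j < length s
imbalance<length s t j (el , eo) j≤ P≢ with m≤n⇒m<n∨m≡n j≤
... | inj₁ j< = j<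
... | inj₂ j≡ = contradiction (begin
  prefixOnes s j           ≡⟨ cong (prefixOnes s) j≡ ⟩
  prefixOnes s (length s)  ≡⟨ prefixOnes-length s ⟩
  ones s                   ≡⟨ eo ⟩
  ones t                   ≡⟨ prefixOnes-length t ⟨
  prefixOnes t (length t)  ≡⟨ cong (prefixOnes t) (trans (sym el) (sym j≡)) ⟩
  prefixOnes t j           ∎) P≢
  where open ≡-Reasoning

isolated⇒DifferByDefects : ∀ s t → Balanced s t → IsolatedImbalances s t → DifferByDefects s t
isolated⇒DifferByDefects s t bal@(el , _) isolated = bal , defect-near
  where
  defect-at : ∀ j → suc j ≤ length s → prefixOnes s j ≡ prefixOnes t j →
    prefixOnes s (suc j) ≢ prefixOnes t (suc j) → Defect s t (suc j)
  defect-at j sj≤ P₀≡ P₁≢ = defect-between-balances s t j (imbalance<length s t (suc j) bal sj≤ P₁≢) el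
    P₀≡ P₁≢ (isolated (suc j) P₁≢)
  defect-near : ∀ i → 1 ≤ i → i ≤ length s → at s i ≢ at t i → Defect s t (pred i) ⊎ Defect s t i
  defect-near (suc j) _ i≤ at≢ with prefixOnes s j ≟ prefixOnes t j
  ... | yes P₀≡ = inj₂ (defect-at j i≤ P₀≡ (prefixOnes-suc-≢ s t j i≤ el P₀≡ at≢))
  defect-near (suc zero)    _ _  _ | no P₀≢ = contradiction refl P₀≢
  defect-near (suc (suc j)) _ i≤ _ | no P₁≢ with prefixOnes s j ≟ prefixOnes t j
  ... | yes P₀≡ = inj₁ (defect-at j (≤-trans (n≤1+n _) i≤) P₀≡ P₁≢)
  ... | no  P₀≢ = contradiction (isolated j P₀≢) P₁≢

defects-after-balanced : ∀ a b → Balanced a b → Eventually DifferByDefects a b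
defects-after-balanced a b bal with iter-σⁿ bal (suc (length a))
... | k , a≡ , b≡ = k , subst₂ DifferByDefects (sym a≡) (sym b≡)
  (isolated⇒DifferByDefects (σ aₙ) (σ bₙ) (σⁿ-Balanced bal (suc n))
    (σ-IsolatedImbalances aₙ bₙ (proj₁ (σⁿ-Balanced bal n))
      (σⁿ-PrefixLead≤ n bal lead-ab) (σⁿ-PrefixLead≤ n (Balanced-sym a b bal) lead-ba)))
  where
  n = length a
  aₙ = iter n σ a
  bₙ = iter n σ b
  lead-ab : PrefixLead≤ a b (suc n)
  lead-ab = PrefixLead≤-length a b
  lead-ba : PrefixLead≤ b a (suc n)
  lead-ba = subst (λ l → PrefixLead≤ b a (suc l)) (sym (proj₁ bal)) (PrefixLead≤-length b a)

corollary1 : (S T : List Bool) → S ≢ [] → T ≢ [] → length S ≡ length T →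
    Σ ℕ (λ k → DifferByDefects (iter k wythoff S) (iter k wythoff T))
corollary1 S T _ _ el with Eventually-Balanced S T el
... | k , bal =
  Eventually-iter {DifferByDefects} k S T (defects-after-balanced (iter k wythoff S) (iter k wythoff T) bal)
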